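{- If $G$ and $H$ are two connected graphs with $\mathrm{toi}(G)=\mathrm{toi}(H)=3$, then $\mathrm{toi}(G \square H) \geq 4$. Furthermore, equality holds when $G=H=K_3$.
   Context: $\mathrm{toi}(G)$ is the maximum $t$ such that $G$ contains a totally odd strong immersion of $K_t$ (pairwise edge-disjoint odd paths joining all pairs of $t$ terminal vertices, with no terminal appearing as an interior vertex of a path). $G\square H$ denotes the Cartesian product: vertex set $V(G)\times V(H)$, with $(g_1,h_1)(g_2,h_2)$ an edge if $g_1=g_2$ and $h_1h_2\in E(H)$, or $h_1=h_2$ and $g_1g_2\in E(G)$. -}

module Defs where

open import Data.Nat using (ℕ; zero; suc; _+_; _*_; _<_; _≤_)
open import Data.Fin using (Fin; toℕ)
open import Data.Fin.Properties using (*↔×)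
open import Data.Product using (Σ; ∃; _×_; _,_; proj₁; proj₂)
open import Data.Sum using (_⊎_; inj₁; inj₂)
open import Data.List using (List; []; _∷_; length; drop)
open import Data.List.Membership.Propositional using (_∈_)
open import Data.List.Relation.Unary.Unique.Propositional using (Unique)
open import Data.Empty using (⊥)
open import Relation.Nullary using (¬_)
open import Relation.Binary.PropositionalEquality using (_≡_; _≢_; refl; sym)
open import Function.Bundles using (_↔_)
open import Function.Properties.Inverse using (↔-sym; ↔-trans)
open import Data.Product.Function.NonDependent.Propositional using (_×-↔_)

record Graph : Set₁ where
  field
    V      : Set
    size   : ℕ
    enum   : V ↔ Fin size
    Adj    : V → V → Set
    adjSym : ∀ {u v} → Adj u v → Adj v u
    adjIrr : ∀ {u} → ¬ Adj u u

open Graph public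

data Walk (G : Graph) : V G → V G → Set where
  stop : (u : V G) → Walk G u u
  step : (u : V G) {v w : V G} → Adj G u v → Walk G v w → Walk G u w

module _ {G : Graph} where

  verts : ∀ {u v} → Walk G u v → List (V G)
  verts (stop u)       = u ∷ []
  verts (step u _ w)   = u ∷ verts w

  len : ∀ {u v} → Walk G u v → ℕ
  len (stop _)     = 0
  len (step _ _ w) = suc (len w)

  edges : ∀ {u v} → Walk G u v → List (V G × V G)
  edges (stop _)                 = []
  edges (step u {v} _ w)         = (u , v) ∷ edges w

  dropLast : List (V G) → List (V G)
  dropLast []            = []
  dropLast (x ∷ [])      = []
  dropLast (x ∷ y ∷ xs)  = x ∷ dropLast (y ∷ xs)

  interior : ∀ {u v} → Walk G u v → List (V G)
  interior w = dropLast (drop 1 (verts w))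

IsPath : (G : Graph) {u v : V G} → Walk G u v → Set
IsPath G w = Unique (verts w)

Odd : ℕ → Set
Odd n = ∃ λ k → n ≡ suc (2 * k)

SameEdge : {A : Set} → A × A → A × A → Set
SameEdge (a , b) (c , d) = (a ≡ c × b ≡ d) ⊎ (a ≡ d × b ≡ c)

EdgeDisjoint : (G : Graph) {a b c d : V G} → Walk G a b → Walk G c d → Set
EdgeDisjoint G P Q = ∀ {e f} → e ∈ edges P → f ∈ edges Q → ¬ SameEdge e f

-- Totally odd strong immersion of K_t in G:
-- t distinct terminals, for each pair i < j an odd path between the
-- terminals of i and j, no terminal is an interior vertex of a path,
-- and paths for distinct pairs are edge-disjoint.

record TOImmersion (G : Graph) (t : ℕ) : Set where
  field
    term      : Fin t → V G
    termInj   : ∀ i j → term i ≡ term j → i ≡ j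
    path      : (i j : Fin t) → toℕ i < toℕ j → Walk G (term i) (term j)
    isPath    : ∀ i j (p : toℕ i < toℕ j) → IsPath G (path i j p)
    odd       : ∀ i j (p : toℕ i < toℕ j) → Odd (len (path i j p))
    noTermInt : ∀ i j (p : toℕ i < toℕ j) k → ¬ (term k ∈ interior (path i j p))
    disjoint  : ∀ i j (p : toℕ i < toℕ j) k l (q : toℕ k < toℕ l) →
                ¬ (i ≡ k × j ≡ l) → EdgeDisjoint G (path i j p) (path k l q)

toi≥ : Graph → ℕ → Set
toi≥ G t = ∃ λ s → t ≤ s × TOImmersion G s

toi≡ : Graph → ℕ → Set
toi≡ G t = TOImmersion G t × (∀ s → TOImmersion G s → s ≤ t)

Connected : Graph → Set
Connected G = ∀ u v → Walk G u v

_□_ : Graph → Graph → Graph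
G □ H = record
  { V      = V G × V H
  ; size   = size G * size H
  ; enum   = ↔-trans (enum G ×-↔ enum H) (↔-sym *↔×)
  ; Adj    = λ { (g₁ , h₁) (g₂ , h₂) →
               (g₁ ≡ g₂ × Adj H h₁ h₂) ⊎ (h₁ ≡ h₂ × Adj G g₁ g₂) }
  ; adjSym = λ { (inj₁ (refl , a)) → inj₁ (refl , adjSym H a)
               ; (inj₂ (refl , a)) → inj₂ (refl , adjSym G a) }
  ; adjIrr = λ { (inj₁ (_ , a)) → adjIrr H a
               ; (inj₂ (_ , a)) → adjIrr G a }
  }

K : ℕ → Graph
K n = record
  { V      = Fin n
  ; size   = n
  ; enum   = record { to = λ x → x ; from = λ x → x
                    ; to-cong = λ e → e ; from-cong = λ e → e
                    ; inverse = (λ e → e) , (λ e → e) }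
  ; Adj    = λ u v → u ≢ v
  ; adjSym = λ ne e → ne (sym e)
  ; adjIrr = λ ne → ne refl
  }

module Submission where

-- Let a₀ a₁ a₂ and b₀ b₁ b₂ be the terminals of the K₃-immersions in G and H, and
-- index the vertices (aₚ , b_q) of G □ H by a 3 × 3 grid.  Take the four corners (aₚ , b_q),
-- p, q ∈ {0, 1}, as terminals of K₄.  The sides of this square are copies of the paths a₀a₁ and
-- b₀b₁ in a row or a column; each diagonal goes round through the third row or column,
-- e.g. (a₀,b₀) → (a₂,b₀) → (a₂,b₁) → (a₁,b₁), a concatenation of three odd paths.  Two such
-- segments are edge-disjoint unless they copy the same path into the same line, and each
-- segment is used by one route only.
--
-- K₃ □ K₃ is vertex-transitive, so a K₅-immersion may be moved to have its first
-- terminal at (0,0).  Its paths have fewer than 9 edges, so an exhaustive search over the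
-- remaining terminals and all candidate paths, which finds nothing, rules it out.

open import Defs
open import Data.Bool.Base using (Bool; true; false; T; not; _∧_; _∨_; if_then_else_)
open import Data.Bool.ListAction using (any; all)
open import Data.Bool.Properties using (T-∧; T-≡)
open import Data.Empty using (⊥-elim)
open import Data.Fin.Base using (Fin; zero; suc; toℕ; _<_; inject≤)
open import Data.Fin.Patterns using (0F; 1F; 2F; 3F; 4F)
open import Data.Fin.Permutation.Components using (transpose; transpose-inverse)
open import Data.Fin.Properties
  using (_≟_; _<?_; <-cmp; <-irrefl; <-asym; all?; pigeonhole; toℕ-inject≤; inject≤-injective)
open import Data.List.Base
  using (List; []; _∷_; _++_; map; concatMap; filter; length; lookup; tabulate;
         cartesianProduct; cartesianProductWith; allFin)
open import Data.List.Membership.Propositional using (_∈_; _∉_; find)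
open import Data.List.Membership.Propositional.Properties
  using (∈-map⁺; ∈-map⁻; ∈-++⁻; ∈-concatMap⁺; ∈-filter⁺; ∈-cartesianProduct⁺;
         ∈-cartesianProductWith⁺; ∈-allFin; ∈-lookup; ∈-tabulate⁻)
open import Data.List.Relation.Unary.All as All using (All; []; _∷_)
open import Data.List.Relation.Unary.All.Properties using (all⁺)
open import Data.List.Relation.Unary.AllPairs using ([]; _∷_) renaming (head to AllPairs-head)
open import Data.List.Relation.Unary.Any as Any using (Any; here; there; any?)
open import Data.List.Relation.Unary.Any.Properties using (any⁺)
open import Data.List.Relation.Unary.Unique.Propositional using (Unique)
open import Data.List.Relation.Unary.Unique.Propositional.Properties using (tabulate⁺)
import Data.List.Relation.Unary.Unique.Propositional.Properties as Unique
import Data.List.Membership.DecPropositional as DecMembership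
import Data.List.Relation.Unary.Unique.DecPropositional as DecUnique
open import Data.Nat.Base as ℕ using (ℕ; zero; suc; _+_; _*_; _≤_; s≤s; parity)
open import Data.Nat.Properties using (+-comm; ≤-refl; ≮⇒≥; ≰⇒>; _≤?_) renaming (_<?_ to _<ℕ?_)
open import Data.Nat.Tactic.RingSolver using (solve-∀)
open import Data.Parity.Base using (1ℙ; _⁻¹)
open import Data.Parity.Properties as ℙ using (+-homo-+; *-homo-*)
open import Data.Product.Base as Product using (_×_; _,_; proj₁; proj₂; ∃; swap; uncurry)
open import Data.Product.Properties using (≡-dec; ×-≡,≡←≡)
open import Data.Sum.Base as Sum using (_⊎_; inj₁; inj₂)
open import Data.Vec.Functional as Vector using (Vector)
open import Function.Base using (_∘_)
open import Function.Bundles using (Inverse; Injection; Equivalence)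
open import Function.Properties.Inverse using (Inverse⇒Injection)
open import Relation.Binary.Definitions using (DecidableEquality; tri<; tri≈; tri>)
open import Relation.Binary.PropositionalEquality
  using (_≡_; _≢_; _≗_; refl; sym; trans; cong; cong₂; subst; subst₂; module ≡-Reasoning)
open import Relation.Nullary.Decidable
  using (Dec; yes; no; does; isYes; _×-dec_; _⊎-dec_; _→-dec_; ¬?; dec-true; dec-false;
         fromWitness; from-yes)
open import Relation.Nullary.Negation using (¬_)

Odd-sum₃ : ∀ {l m n} → Odd l → Odd m → Odd n → Odd (l + (m + n))
Odd-sum₃ (a , refl) (b , refl) (c , refl) = suc (a + b + c) , arithmetic a b c
  where
  arithmetic : ∀ a b c → suc (2 * a) + (suc (2 * b) + suc (2 * c)) ≡ suc (2 * suc (a + b + c))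
  arithmetic = solve-∀

module _ {A : Set} where

  SameEdge-sym : ∀ {e f : A × A} → SameEdge e f → SameEdge f e
  SameEdge-sym (inj₁ (p , q)) = inj₁ (sym p , sym q)
  SameEdge-sym (inj₂ (p , q)) = inj₂ (sym q , sym p)

  SameEdge-swap : ∀ {e f : A × A} → SameEdge e f → SameEdge (swap e) f
  SameEdge-swap (inj₁ (p , q)) = inj₂ (q , p)
  SameEdge-swap (inj₂ (p , q)) = inj₁ (q , p)

  SameEdge-map : ∀ {B : Set} (f : A → B) {a b c d} →
                 SameEdge (a , b) (c , d) → SameEdge (f a , f b) (f c , f d)
  SameEdge-map f (inj₁ (p , q)) = inj₁ (cong f p , cong f q)
  SameEdge-map f (inj₂ (p , q)) = inj₂ (cong f p , cong f q)

  SameEdge-loop : ∀ {a b c : A} → SameEdge (a , b) (c , c) → a ≡ c × b ≡ c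
  SameEdge-loop (inj₁ a≡c,b≡c) = a≡c,b≡c
  SameEdge-loop (inj₂ a≡c,b≡c) = a≡c,b≡c

  Unique-lookup-injective : ∀ {xs : List A} → Unique xs → ∀ {i j} → lookup xs i ≡ lookup xs j → i ≡ j
  Unique-lookup-injective (x∉ ∷ _) {zero}  {zero}  _  = refl
  Unique-lookup-injective (x∉ ∷ _) {zero}  {suc j} eq = ⊥-elim (All.lookup x∉ (∈-lookup j) eq)
  Unique-lookup-injective (x∉ ∷ _) {suc i} {zero}  eq = ⊥-elim (All.lookup x∉ (∈-lookup i) (sym eq))
  Unique-lookup-injective (_ ∷ u)  {suc i} {suc j} eq = cong suc (Unique-lookup-injective u eq)

module _ {G : Graph} where

  infixr 5 _++ʷ_

  _++ʷ_ : ∀ {a b c} → Walk G a b → Walk G b c → Walk G a c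
  stop _     ++ʷ w′ = w′
  step u e w ++ʷ w′ = step u e (w ++ʷ w′)

  reverseʷ : ∀ {a b} → Walk G a b → Walk G b a
  reverseʷ (stop u)     = stop u
  reverseʷ (step u e w) = reverseʷ w ++ʷ step _ (adjSym G e) (stop u)

  len-++ʷ : ∀ {a b c} (w : Walk G a b) (w′ : Walk G b c) → len (w ++ʷ w′) ≡ len w + len w′
  len-++ʷ (stop _)     w′ = refl
  len-++ʷ (step u e w) w′ = cong suc (len-++ʷ w w′)

  len-reverseʷ : ∀ {a b} (w : Walk G a b) → len (reverseʷ w) ≡ len w
  len-reverseʷ (stop _)     = refl
  len-reverseʷ (step u e w) = begin
    len (reverseʷ w ++ʷ step _ (adjSym G e) (stop u)) ≡⟨ len-++ʷ (reverseʷ w) _ ⟩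
    len (reverseʷ w) + 1                              ≡⟨ cong (_+ 1) (len-reverseʷ w) ⟩
    len w + 1                                         ≡⟨ +-comm (len w) 1 ⟩
    suc (len w)                                       ∎
    where open ≡-Reasoning

  Odd-++ʷ₃ : ∀ {a b c d} {A : Walk G a b} {B : Walk G b c} {C : Walk G c d} →
             Odd (len A) → Odd (len B) → Odd (len C) → Odd (len (A ++ʷ B ++ʷ C))
  Odd-++ʷ₃ {A = A} {B} {C} oddA oddB oddC =
    subst Odd (sym (trans (len-++ʷ A (B ++ʷ C)) (cong (len A +_) (len-++ʷ B C))))
          (Odd-sum₃ oddA oddB oddC)

  length-verts : ∀ {a b} (w : Walk G a b) → length (verts w) ≡ suc (len w)
  length-verts (stop _)     = refl
  length-verts (step _ _ w) = cong suc (length-verts w)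

  length-edges : ∀ {a b} (w : Walk G a b) → length (edges w) ≡ len w
  length-edges (stop _)     = refl
  length-edges (step _ _ w) = cong suc (length-edges w)

  edges-++ʷ : ∀ {a b c} (w : Walk G a b) (w′ : Walk G b c) → edges (w ++ʷ w′) ≡ edges w ++ edges w′
  edges-++ʷ (stop _)     w′ = refl
  edges-++ʷ (step u e w) w′ = cong (_ ∷_) (edges-++ʷ w w′)

  ∈-edges-++ʷ⁻ : ∀ {a b c x} (w : Walk G a b) (w′ : Walk G b c) →
                 x ∈ edges (w ++ʷ w′) → x ∈ edges w ⊎ x ∈ edges w′
  ∈-edges-++ʷ⁻ w w′ x∈ = ∈-++⁻ (edges w) (subst (_ ∈_) (edges-++ʷ w w′) x∈)

  ∈-edges⇒Adj : ∀ {a b u v} (w : Walk G a b) → (u , v) ∈ edges w → Adj G u v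
  ∈-edges⇒Adj (step u e w) (here refl) = e
  ∈-edges⇒Adj (step u e w) (there m)   = ∈-edges⇒Adj w m

  ∈-edges-reverseʷ⁻ : ∀ {a b x} (w : Walk G a b) → x ∈ edges (reverseʷ w) → swap x ∈ edges w
  ∈-edges-reverseʷ⁻ (step u e w) x∈ with ∈-edges-++ʷ⁻ (reverseʷ w) _ x∈
  ... | inj₁ x∈w         = there (∈-edges-reverseʷ⁻ w x∈w)
  ... | inj₂ (here refl) = here refl

  first∈verts : ∀ {a b} (w : Walk G a b) → a ∈ verts w
  first∈verts (stop _)     = here refl
  first∈verts (step _ _ _) = here refl

  last∈verts : ∀ {a b} (w : Walk G a b) → b ∈ verts w
  last∈verts (stop _)     = here refl
  last∈verts (step _ _ w) = there (last∈verts w)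

  ∈-verts-++ʷ⁻ : ∀ {a b c x} (w : Walk G a b) (w′ : Walk G b c) →
                 x ∈ verts (w ++ʷ w′) → x ∈ verts w ⊎ x ∈ verts w′
  ∈-verts-++ʷ⁻ (stop _)     w′ x∈          = inj₂ x∈
  ∈-verts-++ʷ⁻ (step u e w) w′ (here refl) = inj₁ (here refl)
  ∈-verts-++ʷ⁻ (step u e w) w′ (there x∈)  = Sum.map₁ there (∈-verts-++ʷ⁻ w w′ x∈)

  ∈-verts-reverseʷ⁻ : ∀ {a b x} (w : Walk G a b) → x ∈ verts (reverseʷ w) → x ∈ verts w
  ∈-verts-reverseʷ⁻ (stop _)     x∈ = x∈
  ∈-verts-reverseʷ⁻ (step u e w) x∈ with ∈-verts-++ʷ⁻ (reverseʷ w) _ x∈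
  ... | inj₁ x∈w                 = there (∈-verts-reverseʷ⁻ w x∈w)
  ... | inj₂ (here refl)         = there (first∈verts w)
  ... | inj₂ (there (here refl)) = here refl

  edge-isPath : ∀ {u v} (e : Adj G u v) → IsPath G (step u e (stop v))
  edge-isPath e = ((λ { refl → adjIrr G e }) ∷ []) ∷ [] ∷ []

  IsPath⇒ends≢ : ∀ {u v b} {e : Adj G u v} (w : Walk G v b) → IsPath G (step u e w) → u ≢ b
  IsPath⇒ends≢ w (u∉w ∷ _) refl = All.lookup u∉w (last∈verts w) refl

  IsPath⇒len< : ∀ {a b} (w : Walk G a b) → IsPath G w → len w ℕ.< size G
  IsPath⇒len< w p with len w <ℕ? size G
  ... | yes short = short
  ... | no ¬short
    with pigeonhole (subst (size G ℕ.<_) (sym (length-verts w)) (s≤s (≮⇒≥ ¬short)))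
                    (Inverse.to (enum G) ∘ lookup (verts w))
  ...   | i , j , i<j , same =
    ⊥-elim (<-irrefl (Unique-lookup-injective p (to-injective same)) i<j)
    where to-injective = Injection.injective (Inverse⇒Injection (enum G))

  ++ʷ-isPath : ∀ {a b c} (w : Walk G a b) (w′ : Walk G b c) → IsPath G w → IsPath G w′ →
               (∀ {x} → x ∈ verts w → x ∈ verts w′ → x ≡ b) → IsPath G (w ++ʷ w′)
  ++ʷ-isPath (stop _)     w′ _         p′ meet = p′
  ++ʷ-isPath (step u e w) w′ (u∉w ∷ p) p′ meet =
    All.tabulate u-fresh ∷ ++ʷ-isPath w w′ p p′ (meet ∘ there)
    where
    u-fresh : ∀ {x} → x ∈ verts (w ++ʷ w′) → u ≢ x
    u-fresh x∈ refl with ∈-verts-++ʷ⁻ w w′ x∈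
    ... | inj₁ u∈w  = All.lookup u∉w u∈w refl
    ... | inj₂ u∈w′ = All.lookup u∉w (last∈verts w) (meet (here refl) u∈w′)

  reverseʷ-isPath : ∀ {a b} (w : Walk G a b) → IsPath G w → IsPath G (reverseʷ w)
  reverseʷ-isPath (stop _)     p         = p
  reverseʷ-isPath (step u e w) (u∉w ∷ p) =
    ++ʷ-isPath (reverseʷ w) last-edge (reverseʷ-isPath w p) (edge-isPath (adjSym G e)) meet
    where
    last-edge = step _ (adjSym G e) (stop u)
    meet : ∀ {x} → x ∈ verts (reverseʷ w) → x ∈ verts last-edge → x ≡ _
    meet _   (here refl)         = refl
    meet x∈w (there (here refl)) = ⊥-elim (All.lookup u∉w (∈-verts-reverseʷ⁻ w x∈w) refl)

  ++ʷ₃-isPath : ∀ {a b c d} (A : Walk G a b) (B : Walk G b c) (C : Walk G c d) →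
                IsPath G A → IsPath G B → IsPath G C →
                (∀ {x} → x ∈ verts A → x ∈ verts B → x ≡ b) →
                (∀ {x} → x ∈ verts B → x ∈ verts C → x ≡ c) →
                (∀ {x} → x ∈ verts A → x ∉ verts C) → IsPath G (A ++ʷ B ++ʷ C)
  ++ʷ₃-isPath A B C pA pB pC meetAB meetBC apartAC =
    ++ʷ-isPath A (B ++ʷ C) pA (++ʷ-isPath B C pB pC meetBC) meet
    where
    meet : ∀ {x} → x ∈ verts A → x ∈ verts (B ++ʷ C) → x ≡ _
    meet x∈A x∈BC with ∈-verts-++ʷ⁻ B C x∈BC
    ... | inj₁ x∈B = meetAB x∈A x∈B
    ... | inj₂ x∈C = ⊥-elim (apartAC x∈A x∈C)

  -- All vertices but the last; interior (step u e w) is front w by definition.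
  front : ∀ {a b} → Walk G a b → List (V G)
  front w = dropLast {G} (verts w)

  front-step : ∀ {u v b} (e : Adj G u v) (w : Walk G v b) → front (step u e w) ≡ u ∷ front w
  front-step e (stop _)     = refl
  front-step e (step _ _ _) = refl

  ∈-front-++ʷ⁻ : ∀ {a b c x} (w : Walk G a b) (w′ : Walk G b c) →
                 x ∈ front (w ++ʷ w′) → x ∈ front w ⊎ x ∈ front w′
  ∈-front-++ʷ⁻ (stop _)     w′ x∈ = inj₂ x∈
  ∈-front-++ʷ⁻ (step u e w) w′ x∈ with subst (_ ∈_) (front-step e (w ++ʷ w′)) x∈
  ... | here refl    = inj₁ (subst (_ ∈_) (sym (front-step e w)) (here refl))
  ... | there x∈rest =
    Sum.map₁ (subst (_ ∈_) (sym (front-step e w)) ∘ there) (∈-front-++ʷ⁻ w w′ x∈rest)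

  ∈-front⁻ : ∀ {a b x} (w : Walk G a b) → x ∈ front w → x ≡ a ⊎ x ∈ interior w
  ∈-front⁻ (step u e w) x∈ with subst (_ ∈_) (front-step e w) x∈
  ... | here refl    = inj₁ refl
  ... | there x∈rest = inj₂ x∈rest

  ∈-interior⇒∈-front : ∀ {a b x} (w : Walk G a b) → x ∈ interior w → x ∈ front w
  ∈-interior⇒∈-front (step u e w) x∈ = subst (_ ∈_) (sym (front-step e w)) (there x∈)

  second∈interior : ∀ {u v w b} (e : Adj G u v) (e′ : Adj G v w) (p : Walk G w b) →
                    v ∈ interior (step u e (step v e′ p))
  second∈interior e e′ p = subst (_ ∈_) (sym (front-step e′ p)) (here refl)

  ∈-interior-++ʷ⁻ : ∀ {a b c x} (w : Walk G a b) (w′ : Walk G b c) →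
                    x ∈ interior (w ++ʷ w′) → x ∈ interior w ⊎ x ≡ b ⊎ x ∈ interior w′
  ∈-interior-++ʷ⁻ (stop _)     w′ x∈ = inj₂ (inj₂ x∈)
  ∈-interior-++ʷ⁻ (step u e w) w′ x∈ = Sum.map₂ (∈-front⁻ w′) (∈-front-++ʷ⁻ w w′ x∈)

  ∈-interior-reverseʷ⁻ : ∀ {a b x} (w : Walk G a b) → x ∈ interior (reverseʷ w) → x ∈ interior w
  ∈-interior-reverseʷ⁻ (step u e w@(step v e′ w₀)) x∈ =
    Sum.[ ∈-interior⇒∈-front w ∘ ∈-interior-reverseʷ⁻ w
        , Sum.[ (λ { refl → second∈interior e e′ w₀ }) , (λ ()) ] ]
      (∈-interior-++ʷ⁻ (reverseʷ w) _ x∈)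

  EdgeDisjoint-sym : ∀ {a b c d} {P : Walk G a b} {Q : Walk G c d} →
                     EdgeDisjoint G P Q → EdgeDisjoint G Q P
  EdgeDisjoint-sym disj f∈ e∈ same = disj e∈ f∈ (SameEdge-sym same)

  EdgeDisjoint-reverseˡ : ∀ {a b c d} (P : Walk G a b) {Q : Walk G c d} →
                          EdgeDisjoint G P Q → EdgeDisjoint G (reverseʷ P) Q
  EdgeDisjoint-reverseˡ P disj e∈ f∈ same = disj (∈-edges-reverseʷ⁻ P e∈) f∈ (SameEdge-swap same)

  EdgeDisjoint-reverseʳ : ∀ {a b c d} {P : Walk G a b} (Q : Walk G c d) →
                          EdgeDisjoint G P Q → EdgeDisjoint G P (reverseʷ Q)
  EdgeDisjoint-reverseʳ Q disj = EdgeDisjoint-sym (EdgeDisjoint-reverseˡ Q (EdgeDisjoint-sym disj))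

record Embedding (G H : Graph) : Set where
  field
    to        : V G → V H
    injective : ∀ {u v} → to u ≡ to v → u ≡ v
    adjacent  : ∀ {u v} → Adj G u v → Adj H (to u) (to v)

module _ {G H : Graph} (φ : Embedding G H) where
  open Embedding φ

  mapʷ : ∀ {a b} → Walk G a b → Walk H (to a) (to b)
  mapʷ (stop u)     = stop (to u)
  mapʷ (step u e w) = step (to u) (adjacent e) (mapʷ w)

  len-mapʷ : ∀ {a b} (w : Walk G a b) → len (mapʷ w) ≡ len w
  len-mapʷ (stop _)     = refl
  len-mapʷ (step _ _ w) = cong suc (len-mapʷ w)

  verts-mapʷ : ∀ {a b} (w : Walk G a b) → verts (mapʷ w) ≡ map to (verts w)
  verts-mapʷ (stop _)     = refl
  verts-mapʷ (step _ _ w) = cong (_ ∷_) (verts-mapʷ w)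

  edges-mapʷ : ∀ {a b} (w : Walk G a b) → edges (mapʷ w) ≡ map (Product.map to to) (edges w)
  edges-mapʷ (stop _)     = refl
  edges-mapʷ (step _ _ w) = cong (_ ∷_) (edges-mapʷ w)

  front-mapʷ : ∀ {a b} (w : Walk G a b) → front (mapʷ w) ≡ map to (front w)
  front-mapʷ (stop _)     = refl
  front-mapʷ (step u e w) = begin
    front (step (to u) (adjacent e) (mapʷ w)) ≡⟨ front-step (adjacent e) (mapʷ w) ⟩
    to u ∷ front (mapʷ w)                     ≡⟨ cong (to u ∷_) (front-mapʷ w) ⟩
    map to (u ∷ front w)                      ≡⟨ cong (map to) (front-step e w) ⟨
    map to (front (step u e w))               ∎
    where open ≡-Reasoning

  interior-mapʷ : ∀ {a b} (w : Walk G a b) → interior (mapʷ w) ≡ map to (interior w)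
  interior-mapʷ (stop _)     = refl
  interior-mapʷ (step _ _ w) = front-mapʷ w

  ∈-map-to⁻ : ∀ {x xs} → to x ∈ map to xs → x ∈ xs
  ∈-map-to⁻ x∈ with ∈-map⁻ to x∈
  ... | _ , y∈ , eq = subst (_∈ _) (sym (injective eq)) y∈

  ∈-edges-mapʷ⁻ : ∀ {a b x} (w : Walk G a b) → x ∈ edges (mapʷ w) →
                  ∃ λ e → e ∈ edges w × x ≡ Product.map to to e
  ∈-edges-mapʷ⁻ w x∈ = ∈-map⁻ (Product.map to to) (subst (_ ∈_) (edges-mapʷ w) x∈)

  mapʷ-isPath : ∀ {a b} (w : Walk G a b) → IsPath G w → IsPath H (mapʷ w)
  mapʷ-isPath w p = subst Unique (sym (verts-mapʷ w)) (Unique.map⁺ injective p)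

  mapʷ-edgeDisjoint : ∀ {a b c d} (P : Walk G a b) (Q : Walk G c d) →
                      EdgeDisjoint G P Q → EdgeDisjoint H (mapʷ P) (mapʷ Q)
  mapʷ-edgeDisjoint P Q disj e∈ f∈ same
    with ∈-edges-mapʷ⁻ P e∈ | ∈-edges-mapʷ⁻ Q f∈ | same
  ... | _ , e∈P , refl | _ , f∈Q , refl | inj₁ (p , q) = disj e∈P f∈Q (inj₁ (injective p , injective q))
  ... | _ , e∈P , refl | _ , f∈Q , refl | inj₂ (p , q) = disj e∈P f∈Q (inj₂ (injective p , injective q))

  mapImmersion : ∀ {t} → TOImmersion G t → TOImmersion H t
  mapImmersion I = record
    { term      = to ∘ term
    ; termInj   = λ i j → termInj i j ∘ injective
    ; path      = λ i j p → mapʷ (path i j p)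
    ; isPath    = λ i j p → mapʷ-isPath (path i j p) (isPath i j p)
    ; odd       = λ i j p → subst Odd (sym (len-mapʷ (path i j p))) (odd i j p)
    ; noTermInt = λ i j p k →
        noTermInt i j p k ∘ ∈-map-to⁻ ∘ subst (_ ∈_) (interior-mapʷ (path i j p))
    ; disjoint  = λ i j p k l q different →
        mapʷ-edgeDisjoint (path i j p) (path k l q) (disjoint i j p k l q different)
    }
    where open TOImmersion I

K-embedding : ∀ {n} (f : Fin n → Fin n) → (∀ {x y} → f x ≡ f y → x ≡ y) → Embedding (K n) (K n)
K-embedding f injective = record { to = f ; injective = injective ; adjacent = λ x≢y → x≢y ∘ injective }

_□ᴱ_ : ∀ {G G′ H H′} → Embedding G G′ → Embedding H H′ → Embedding (G □ H) (G′ □ H′)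
φ □ᴱ ψ = record
  { to        = Product.map φ.to ψ.to
  ; injective = λ eq → cong₂ _,_ (φ.injective (cong proj₁ eq)) (ψ.injective (cong proj₂ eq))
  ; adjacent  = λ { (inj₁ (refl , e)) → inj₁ (refl , ψ.adjacent e)
                  ; (inj₂ (refl , e)) → inj₂ (refl , φ.adjacent e) }
  }
  where
  module φ = Embedding φ
  module ψ = Embedding ψ

transpose-injective : ∀ {n} {i j x y : Fin n} → transpose i j x ≡ transpose i j y → x ≡ y
transpose-injective {i = i} {j} {x} {y} eq = begin
  x                               ≡⟨ transpose-inverse j i ⟨
  transpose j i (transpose i j x) ≡⟨ cong (transpose j i) eq ⟩
  transpose j i (transpose i j y) ≡⟨ transpose-inverse j i ⟩
  y                               ∎
  where open ≡-Reasoning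

transpose-sends : ∀ {n} (i j : Fin n) → transpose i j i ≡ j
transpose-sends i j rewrite dec-true (i ≟ i) refl = refl

module _ {G H : Graph} where

  row : V H → Embedding G (G □ H)
  row h = record { to = _, h ; injective = cong proj₁ ; adjacent = λ e → inj₂ (refl , e) }

  column : V G → Embedding H (G □ H)
  column g = record { to = g ,_ ; injective = cong proj₂ ; adjacent = λ e → inj₁ (refl , e) }

  ∈-verts-row⁻ : ∀ {h a b x} (P : Walk G a b) → x ∈ verts (mapʷ (row h) P) → proj₂ x ≡ h
  ∈-verts-row⁻ {h} P x∈ with ∈-map⁻ (_, h) (subst (_ ∈_) (verts-mapʷ (row h) P) x∈)
  ... | _ , _ , refl = refl

  ∈-verts-column⁻ : ∀ {g a b x} (Q : Walk H a b) → x ∈ verts (mapʷ (column g) Q) → proj₁ x ≡ g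
  ∈-verts-column⁻ {g} Q x∈ with ∈-map⁻ (g ,_) (subst (_ ∈_) (verts-mapʷ (column g) Q) x∈)
  ... | _ , _ , refl = refl

  row-column-meet : ∀ {h g a b c d x} (P : Walk G a b) (Q : Walk H c d) →
                    x ∈ verts (mapʷ (row h) P) → x ∈ verts (mapʷ (column g) Q) → x ≡ (g , h)
  row-column-meet P Q x∈P x∈Q = cong₂ _,_ (∈-verts-column⁻ Q x∈Q) (∈-verts-row⁻ P x∈P)

  rows-apart : ∀ {h h′ a b c d x} → h ≢ h′ → (P : Walk G a b) (P′ : Walk G c d) →
               x ∈ verts (mapʷ (row h) P) → x ∉ verts (mapʷ (row h′) P′)
  rows-apart h≢h′ P P′ x∈P x∈P′ = h≢h′ (trans (sym (∈-verts-row⁻ P x∈P)) (∈-verts-row⁻ P′ x∈P′))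

  columns-apart : ∀ {g g′ a b c d x} → g ≢ g′ → (Q : Walk H a b) (Q′ : Walk H c d) →
                  x ∈ verts (mapʷ (column g) Q) → x ∉ verts (mapʷ (column g′) Q′)
  columns-apart g≢g′ Q Q′ x∈Q x∈Q′ =
    g≢g′ (trans (sym (∈-verts-column⁻ Q x∈Q)) (∈-verts-column⁻ Q′ x∈Q′))

  rows-edgeDisjoint : ∀ {h h′ a b c d} → h ≢ h′ → (P : Walk G a b) (P′ : Walk G c d) →
                      EdgeDisjoint (G □ H) (mapʷ (row h) P) (mapʷ (row h′) P′)
  rows-edgeDisjoint {h} {h′} h≢h′ P P′ e∈ f∈ same
    with ∈-edges-mapʷ⁻ (row h) P e∈ | ∈-edges-mapʷ⁻ (row h′) P′ f∈
  ... | _ , _ , refl | _ , _ , refl = h≢h′ (proj₁ (SameEdge-loop (SameEdge-map proj₂ same)))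

  columns-edgeDisjoint : ∀ {g g′ a b c d} → g ≢ g′ → (Q : Walk H a b) (Q′ : Walk H c d) →
                         EdgeDisjoint (G □ H) (mapʷ (column g) Q) (mapʷ (column g′) Q′)
  columns-edgeDisjoint {g} {g′} g≢g′ Q Q′ e∈ f∈ same
    with ∈-edges-mapʷ⁻ (column g) Q e∈ | ∈-edges-mapʷ⁻ (column g′) Q′ f∈
  ... | _ , _ , refl | _ , _ , refl = g≢g′ (proj₁ (SameEdge-loop (SameEdge-map proj₁ same)))

  row-column-edgeDisjoint : ∀ {h g a b c d} (P : Walk G a b) (Q : Walk H c d) →
                            EdgeDisjoint (G □ H) (mapʷ (row h) P) (mapʷ (column g) Q)
  row-column-edgeDisjoint {h} {g} P Q e∈ f∈ same
    with ∈-edges-mapʷ⁻ (row h) P e∈ | ∈-edges-mapʷ⁻ (column g) Q f∈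
  ... | _ , e∈P , refl | _ , _ , refl with SameEdge-loop (SameEdge-map proj₁ same)
  ...   | refl , refl = adjIrr G (∈-edges⇒Adj P e∈P)

module _ {G : Graph} {t : ℕ} (I : TOImmersion G t) where
  open TOImmersion I

  link : (i j : Fin t) → Walk G (term i) (term j)
  link i j with <-cmp i j
  ... | tri< i<j _ _  = path i j i<j
  ... | tri≈ _ refl _ = stop (term i)
  ... | tri> _ _ j<i  = reverseʷ (path j i j<i)

  link-isPath : ∀ i j → IsPath G (link i j)
  link-isPath i j with <-cmp i j
  ... | tri< i<j _ _  = isPath i j i<j
  ... | tri≈ _ refl _ = [] ∷ []
  ... | tri> _ _ j<i  = reverseʷ-isPath (path j i j<i) (isPath j i j<i)

  link-odd : ∀ {i j} → i ≢ j → Odd (len (link i j))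
  link-odd {i} {j} i≢j with <-cmp i j
  ... | tri< i<j _ _ = odd i j i<j
  ... | tri≈ _ i≡j _ = ⊥-elim (i≢j i≡j)
  ... | tri> _ _ j<i = subst Odd (sym (len-reverseʷ (path j i j<i))) (odd j i j<i)

  link-avoids-terminals : ∀ i j k → term k ∉ interior (link i j)
  link-avoids-terminals i j k with <-cmp i j
  ... | tri< i<j _ _  = noTermInt i j i<j k
  ... | tri≈ _ refl _ = λ ()
  ... | tri> _ _ j<i  = noTermInt j i j<i k ∘ ∈-interior-reverseʷ⁻ (path j i j<i)

  link-edgeDisjoint : ∀ {i j k l} → ¬ SameEdge (i , j) (k , l) → EdgeDisjoint G (link i j) (link k l)
  link-edgeDisjoint {i} {j} {k} {l} different with <-cmp i j | <-cmp k l
  ... | tri≈ _ refl _ | _             = λ ()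
  ... | tri< _ _ _    | tri≈ _ refl _ = λ _ ()
  ... | tri> _ _ _    | tri≈ _ refl _ = λ _ ()
  ... | tri< i<j _ _  | tri< k<l _ _  = disjoint i j i<j k l k<l (different ∘ inj₁)
  ... | tri< i<j _ _  | tri> _ _ l<k  =
    EdgeDisjoint-reverseʳ (path l k l<k) (disjoint i j i<j l k l<k (different ∘ inj₂))
  ... | tri> _ _ j<i  | tri< k<l _ _  =
    EdgeDisjoint-reverseˡ (path j i j<i) (disjoint j i j<i k l k<l (different ∘ inj₂ ∘ swap))
  ... | tri> _ _ j<i  | tri> _ _ l<k  =
    EdgeDisjoint-reverseˡ (path j i j<i) (EdgeDisjoint-reverseʳ (path l k l<k)
      (disjoint j i j<i l k l<k (different ∘ inj₁ ∘ swap)))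

restrict : ∀ {G s t} → t ≤ s → TOImmersion G s → TOImmersion G t
restrict {t = t} t≤s I = record
  { term      = term ∘ ι
  ; termInj   = λ i j → ι-injective ∘ termInj (ι i) (ι j)
  ; path      = λ i j i<j → path (ι i) (ι j) (ι-mono i<j)
  ; isPath    = λ i j i<j → isPath (ι i) (ι j) (ι-mono i<j)
  ; odd       = λ i j i<j → odd (ι i) (ι j) (ι-mono i<j)
  ; noTermInt = λ i j i<j k → noTermInt (ι i) (ι j) (ι-mono i<j) (ι k)
  ; disjoint  = λ i j i<j k l k<l different →
      disjoint (ι i) (ι j) (ι-mono i<j) (ι k) (ι l) (ι-mono k<l)
               (λ (i≡k , j≡l) → different (ι-injective i≡k , ι-injective j≡l))
  }
  where
  open TOImmersion I
  ι : Fin t → Fin _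
  ι i = inject≤ i t≤s
  ι-injective : ∀ {i j} → ι i ≡ ι j → i ≡ j
  ι-injective = inject≤-injective t≤s t≤s _ _
  ι-mono : ∀ {i j} → i < j → ι i < ι j
  ι-mono {i} {j} = subst₂ ℕ._<_ (sym (toℕ-inject≤ i t≤s)) (sym (toℕ-inject≤ j t≤s))

complete-immersion : ∀ n → TOImmersion (K n) n
complete-immersion n = record
  { term      = λ i → i
  ; termInj   = λ _ _ i≡j → i≡j
  ; path      = λ i j i<j → step i (<⇒≢ i<j) (stop j)
  ; isPath    = λ i j i<j → edge-isPath {K n} (<⇒≢ i<j)
  ; odd       = λ _ _ _ → 0 , refl
  ; noTermInt = λ _ _ _ _ ()
  ; disjoint  = λ i j i<j k l k<l different → λ where
      (here refl) (here refl) (inj₁ same)          → different same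
      (here refl) (here refl) (inj₂ (refl , refl)) → <-asym i<j k<l
  }
  where
  <⇒≢ : ∀ {i j : Fin n} → i < j → i ≢ j
  <⇒≢ i<j refl = <-irrefl refl i<j

-- Lower bound: K₄ in the product of two graphs with toi ≥ 3

data Axis : Set where
  horizontal vertical : Axis

data Segment : Set where
  segment : Axis → (line i j : Fin 3) → Segment

startIx endIx : Segment → Fin 3 × Fin 3
startIx (segment horizontal ℓ i j) = i , ℓ
startIx (segment vertical   ℓ i j) = ℓ , i
endIx   (segment horizontal ℓ i j) = j , ℓ
endIx   (segment vertical   ℓ i j) = ℓ , j

-- toℕ i + toℕ j determines the unordered pair {i, j} of distinct indices of Fin 3.
key : Segment → Axis × Fin 3 × ℕ
key (segment d ℓ i j) = d , ℓ , toℕ i + toℕ j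

infixr 5 _∷_
data Chain : Fin 3 × Fin 3 → Fin 3 × Fin 3 → Set where
  [_] : (s : Segment) → Chain (startIx s) (endIx s)
  _∷_ : ∀ {q} (s : Segment) → Chain (endIx s) q → Chain (startIx s) q

segments : ∀ {p q} → Chain p q → List Segment
segments [ s ]   = s ∷ []
segments (s ∷ c) = s ∷ segments c

junctions : ∀ {p q} → Chain p q → List (Fin 3 × Fin 3)
junctions [ s ]   = []
junctions (s ∷ c) = endIx s ∷ junctions c

zigzag : (d : Axis) (ℓ ℓ′ i j k : Fin 3) →
         Chain (startIx (segment d ℓ i j)) (endIx (segment d ℓ′ j k))
zigzag horizontal ℓ ℓ′ i j k =
  segment horizontal ℓ i j ∷ segment vertical j ℓ ℓ′ ∷ [ segment horizontal ℓ′ j k ]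
zigzag vertical   ℓ ℓ′ i j k =
  segment vertical ℓ i j ∷ segment horizontal j ℓ ℓ′ ∷ [ segment vertical ℓ′ j k ]

_≟ₓ_ : DecidableEquality (Fin 3 × Fin 3)
_≟ₓ_ = ≡-dec _≟_ _≟_

open DecMembership _≟ₓ_ using (_∈?_)

corner : Fin 4 → Fin 3 × Fin 3
corner 0F = 0F , 0F
corner 1F = 1F , 0F
corner 2F = 0F , 1F
corner 3F = 1F , 1F

corner-injective : ∀ k k′ → corner k ≡ corner k′ → k ≡ k′
corner-injective = from-yes (all? λ k → all? λ k′ → corner k ≟ₓ corner k′ →-dec k ≟ k′)

data Pair : Fin 4 → Fin 4 → Set where
  p01 : Pair 0F 1F
  p02 : Pair 0F 2F
  p03 : Pair 0F 3F
  p12 : Pair 1F 2F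
  p13 : Pair 1F 3F
  p23 : Pair 2F 3F

pair : ∀ {i j} → i < j → Pair i j
pair {0F} {1F} _ = p01
pair {0F} {2F} _ = p02
pair {0F} {3F} _ = p03
pair {1F} {2F} _ = p12
pair {1F} {3F} _ = p13
pair {2F} {3F} _ = p23
pair {0F} {0F} ()
pair {1F} {0F} ()
pair {1F} {1F} (s≤s ())
pair {2F} {0F} ()
pair {2F} {1F} (s≤s ())
pair {2F} {2F} (s≤s (s≤s ()))
pair {3F} {0F} ()
pair {3F} {1F} (s≤s ())
pair {3F} {2F} (s≤s (s≤s ()))
pair {3F} {3F} (s≤s (s≤s (s≤s ())))

route : ∀ {i j} → Pair i j → Chain (corner i) (corner j)
route p01 = [ segment horizontal 0F 0F 1F ]
route p02 = [ segment vertical   0F 0F 1F ]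
route p13 = [ segment vertical   1F 0F 1F ]
route p23 = [ segment horizontal 1F 0F 1F ]
route p03 = zigzag horizontal 0F 1F 0F 2F 1F
route p12 = zigzag vertical   1F 0F 0F 2F 1F

-- The route that uses a segment with this key ((0F , 0F) for keys no route uses).  Since this is
-- a function of the key, no segment is shared by two routes.
owner : Axis × Fin 3 × ℕ → Fin 4 × Fin 4
owner (horizontal , 0F , 1) = 0F , 1F
owner (vertical   , 0F , 1) = 0F , 2F
owner (vertical   , 1F , 1) = 1F , 3F
owner (horizontal , 1F , 1) = 2F , 3F
owner (horizontal , 0F , 2) = 0F , 3F
owner (vertical   , 2F , 1) = 0F , 3F
owner (horizontal , 1F , 3) = 0F , 3F
owner (vertical   , 1F , 2) = 1F , 2F
owner (horizontal , 2F , 1) = 1F , 2F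
owner (vertical   , 0F , 3) = 1F , 2F
owner _                     = 0F , 0F

owner-route : ∀ {i j} (p : Pair i j) → All (λ s → owner (key s) ≡ (i , j)) (segments (route p))
owner-route p01 = refl ∷ []
owner-route p02 = refl ∷ []
owner-route p13 = refl ∷ []
owner-route p23 = refl ∷ []
owner-route p03 = refl ∷ refl ∷ refl ∷ []
owner-route p12 = refl ∷ refl ∷ refl ∷ []

routes-keys-apart : ∀ {i j k l} (p : Pair i j) (q : Pair k l) → ¬ (i ≡ k × j ≡ l) →
                    ∀ {s s′} → s ∈ segments (route p) → s′ ∈ segments (route q) → key s ≢ key s′
routes-keys-apart {i} {j} {k} {l} p q different {s} {s′} s∈ s′∈ same-key =
  different (×-≡,≡←≡ (begin
    (i , j)        ≡⟨ All.lookup (owner-route p) s∈ ⟨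
    owner (key s)  ≡⟨ cong owner same-key ⟩
    owner (key s′) ≡⟨ All.lookup (owner-route q) s′∈ ⟩
    (k , l)        ∎))
  where open ≡-Reasoning

corner-∉-junctions : ∀ {i j} (p : Pair i j) k → corner k ∉ junctions (route p)
corner-∉-junctions p01 _ ()
corner-∉-junctions p02 _ ()
corner-∉-junctions p13 _ ()
corner-∉-junctions p23 _ ()
corner-∉-junctions p03 = from-yes (all? λ k → ¬? (corner k ∈? junctions (route p03)))
corner-∉-junctions p12 = from-yes (all? λ k → ¬? (corner k ∈? junctions (route p12)))

SameEdge⇒sum≡ : ∀ {i j k l : Fin 3} → SameEdge (i , j) (k , l) → toℕ i + toℕ j ≡ toℕ k + toℕ l
SameEdge⇒sum≡ (inj₁ (refl , refl)) = refl
SameEdge⇒sum≡ {i} {j} (inj₂ (refl , refl)) = +-comm (toℕ i) (toℕ j)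

module _ {G H : Graph} (I : TOImmersion G 3) (J : TOImmersion H 3) where
  private
    module I = TOImmersion I
    module J = TOImmersion J

  grid : Fin 3 × Fin 3 → V (G □ H)
  grid (p , q) = I.term p , J.term q

  grid-injective : ∀ {x y} → grid x ≡ grid y → x ≡ y
  grid-injective eq = cong₂ _,_ (I.termInj _ _ (cong proj₁ eq)) (J.termInj _ _ (cong proj₂ eq))

  segmentWalk : (s : Segment) → Walk (G □ H) (grid (startIx s)) (grid (endIx s))
  segmentWalk (segment horizontal ℓ i j) = mapʷ (row (J.term ℓ)) (link I i j)
  segmentWalk (segment vertical   ℓ i j) = mapʷ (column (I.term ℓ)) (link J i j)

  chainWalk : ∀ {p q} → Chain p q → Walk (G □ H) (grid p) (grid q)
  chainWalk [ s ]   = segmentWalk s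
  chainWalk (s ∷ c) = segmentWalk s ++ʷ chainWalk c

  segment-isPath : ∀ s → IsPath (G □ H) (segmentWalk s)
  segment-isPath (segment horizontal ℓ i j) = mapʷ-isPath (row _) (link I i j) (link-isPath I i j)
  segment-isPath (segment vertical   ℓ i j) = mapʷ-isPath (column _) (link J i j) (link-isPath J i j)

  segment-odd : ∀ d ℓ {i j} → i ≢ j → Odd (len (segmentWalk (segment d ℓ i j)))
  segment-odd horizontal ℓ {i} {j} i≢j =
    subst Odd (sym (len-mapʷ (row _) (link I i j))) (link-odd I i≢j)
  segment-odd vertical   ℓ {i} {j} i≢j =
    subst Odd (sym (len-mapʷ (column _) (link J i j))) (link-odd J i≢j)

  grid-∉-segment-interior : ∀ s x → grid x ∉ interior (segmentWalk s)
  grid-∉-segment-interior (segment horizontal ℓ i j) (p , q) x∈ with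
    ∈-map⁻ (_, J.term ℓ) (subst (_ ∈_) (interior-mapʷ (row _) (link I i j)) x∈)
  ... | _ , y∈ , eq = link-avoids-terminals I i j p (subst (_∈ _) (sym (cong proj₁ eq)) y∈)
  grid-∉-segment-interior (segment vertical ℓ i j) (p , q) x∈ with
    ∈-map⁻ (I.term ℓ ,_) (subst (_ ∈_) (interior-mapʷ (column _) (link J i j)) x∈)
  ... | _ , y∈ , eq = link-avoids-terminals J i j q (subst (_∈ _) (sym (cong proj₂ eq)) y∈)

  segment-edgeDisjoint : ∀ s s′ → key s ≢ key s′ → EdgeDisjoint (G □ H) (segmentWalk s) (segmentWalk s′)
  segment-edgeDisjoint (segment horizontal ℓ i j) (segment horizontal ℓ′ k l) apart with ℓ ≟ ℓ′
  ... | yes refl = mapʷ-edgeDisjoint (row _) (link I i j) (link I k l)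
                     (link-edgeDisjoint I (apart ∘ cong (λ n → horizontal , ℓ , n) ∘ SameEdge⇒sum≡))
  ... | no ℓ≢ℓ′ = rows-edgeDisjoint (ℓ≢ℓ′ ∘ J.termInj ℓ ℓ′) (link I i j) (link I k l)
  segment-edgeDisjoint (segment vertical ℓ i j) (segment vertical ℓ′ k l) apart with ℓ ≟ ℓ′
  ... | yes refl = mapʷ-edgeDisjoint (column _) (link J i j) (link J k l)
                     (link-edgeDisjoint J (apart ∘ cong (λ n → vertical , ℓ , n) ∘ SameEdge⇒sum≡))
  ... | no ℓ≢ℓ′ = columns-edgeDisjoint (ℓ≢ℓ′ ∘ I.termInj ℓ ℓ′) (link J i j) (link J k l)
  segment-edgeDisjoint (segment horizontal ℓ i j) (segment vertical ℓ′ k l) _ =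
    row-column-edgeDisjoint (link I i j) (link J k l)
  segment-edgeDisjoint (segment vertical ℓ i j) (segment horizontal ℓ′ k l) _ =
    EdgeDisjoint-sym (row-column-edgeDisjoint (link I k l) (link J i j))

  ∈-edges-chain⁻ : ∀ {p q e} (c : Chain p q) → e ∈ edges (chainWalk c) →
                   ∃ λ s → s ∈ segments c × e ∈ edges (segmentWalk s)
  ∈-edges-chain⁻ [ s ]   e∈ = s , here refl , e∈
  ∈-edges-chain⁻ (s ∷ c) e∈ with ∈-edges-++ʷ⁻ (segmentWalk s) (chainWalk c) e∈
  ... | inj₁ e∈s = s , here refl , e∈s
  ... | inj₂ e∈c = let s′ , s′∈ , e∈s′ = ∈-edges-chain⁻ c e∈c in s′ , there s′∈ , e∈s′

  grid-∈-chain-interior⁻ : ∀ {p q x} (c : Chain p q) → grid x ∈ interior (chainWalk c) → x ∈ junctions c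
  grid-∈-chain-interior⁻ [ s ] x∈ = ⊥-elim (grid-∉-segment-interior s _ x∈)
  grid-∈-chain-interior⁻ (s ∷ c) x∈ with ∈-interior-++ʷ⁻ (segmentWalk s) (chainWalk c) x∈
  ... | inj₁ x∈s          = ⊥-elim (grid-∉-segment-interior s _ x∈s)
  ... | inj₂ (inj₁ x≡end) = here (grid-injective x≡end)
  ... | inj₂ (inj₂ x∈c)   = there (grid-∈-chain-interior⁻ c x∈c)

  zigzag-isPath : ∀ d ℓ ℓ′ i j k → ℓ ≢ ℓ′ → IsPath (G □ H) (chainWalk (zigzag d ℓ ℓ′ i j k))
  zigzag-isPath horizontal ℓ ℓ′ i j k ℓ≢ℓ′ =
    ++ʷ₃-isPath _ _ _
      (segment-isPath (segment horizontal ℓ i j))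
      (segment-isPath (segment vertical j ℓ ℓ′))
      (segment-isPath (segment horizontal ℓ′ j k))
      (row-column-meet (link I i j) (link J ℓ ℓ′))
      (λ x∈B x∈C → row-column-meet (link I j k) (link J ℓ ℓ′) x∈C x∈B)
      (rows-apart (ℓ≢ℓ′ ∘ J.termInj ℓ ℓ′) (link I i j) (link I j k))
  zigzag-isPath vertical ℓ ℓ′ i j k ℓ≢ℓ′ =
    ++ʷ₃-isPath _ _ _
      (segment-isPath (segment vertical ℓ i j))
      (segment-isPath (segment horizontal j ℓ ℓ′))
      (segment-isPath (segment vertical ℓ′ j k))
      (λ x∈A x∈B → row-column-meet (link I ℓ ℓ′) (link J i j) x∈B x∈A)
      (row-column-meet (link I ℓ ℓ′) (link J j k))
      (columns-apart (ℓ≢ℓ′ ∘ I.termInj ℓ ℓ′) (link J i j) (link J j k))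

  zigzag-odd : ∀ d ℓ ℓ′ i j k → i ≢ j → ℓ ≢ ℓ′ → j ≢ k → Odd (len (chainWalk (zigzag d ℓ ℓ′ i j k)))
  zigzag-odd horizontal ℓ ℓ′ i j k i≢j ℓ≢ℓ′ j≢k =
    Odd-++ʷ₃ (segment-odd horizontal ℓ i≢j) (segment-odd vertical j ℓ≢ℓ′) (segment-odd horizontal ℓ′ j≢k)
  zigzag-odd vertical ℓ ℓ′ i j k i≢j ℓ≢ℓ′ j≢k =
    Odd-++ʷ₃ (segment-odd vertical ℓ i≢j) (segment-odd horizontal j ℓ≢ℓ′) (segment-odd vertical ℓ′ j≢k)

  route-isPath : ∀ {i j} (p : Pair i j) → IsPath (G □ H) (chainWalk (route p))
  route-isPath p01 = segment-isPath (segment horizontal 0F 0F 1F)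
  route-isPath p02 = segment-isPath (segment vertical   0F 0F 1F)
  route-isPath p13 = segment-isPath (segment vertical   1F 0F 1F)
  route-isPath p23 = segment-isPath (segment horizontal 1F 0F 1F)
  route-isPath p03 = zigzag-isPath horizontal 0F 1F 0F 2F 1F (λ ())
  route-isPath p12 = zigzag-isPath vertical   1F 0F 0F 2F 1F (λ ())

  route-odd : ∀ {i j} (p : Pair i j) → Odd (len (chainWalk (route p)))
  route-odd p01 = segment-odd horizontal 0F (λ ())
  route-odd p02 = segment-odd vertical   0F (λ ())
  route-odd p13 = segment-odd vertical   1F (λ ())
  route-odd p23 = segment-odd horizontal 1F (λ ())
  route-odd p03 = zigzag-odd horizontal 0F 1F 0F 2F 1F (λ ()) (λ ()) (λ ())
  route-odd p12 = zigzag-odd vertical   1F 0F 0F 2F 1F (λ ()) (λ ()) (λ ())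

  routes-edgeDisjoint : ∀ {i j k l} (p : Pair i j) (q : Pair k l) → ¬ (i ≡ k × j ≡ l) →
                        EdgeDisjoint (G □ H) (chainWalk (route p)) (chainWalk (route q))
  routes-edgeDisjoint p q different e∈ f∈ with ∈-edges-chain⁻ (route p) e∈ | ∈-edges-chain⁻ (route q) f∈
  ... | s , s∈ , e∈s | s′ , s′∈ , f∈s′ =
    segment-edgeDisjoint s s′ (routes-keys-apart p q different s∈ s′∈) e∈s f∈s′

  □-immersion : TOImmersion (G □ H) 4
  □-immersion = record
    { term      = grid ∘ corner
    ; termInj   = λ k k′ → corner-injective k k′ ∘ grid-injective
    ; path      = λ i j i<j → chainWalk (route (pair i<j))
    ; isPath    = λ i j i<j → route-isPath (pair i<j)
    ; odd       = λ i j i<j → route-odd (pair i<j)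
    ; noTermInt = λ i j i<j k →
        corner-∉-junctions (pair i<j) k ∘ grid-∈-chain-interior⁻ (route (pair i<j))
    ; disjoint  = λ i j i<j k l k<l → routes-edgeDisjoint (pair i<j) (pair k<l)
    }

-- Upper bound: no K₅ in K₃ □ K₃

K₃□K₃ : Graph
K₃□K₃ = K 3 □ K 3

Vertex : Set
Vertex = V K₃□K₃

Edge : Set
Edge = Vertex × Vertex

origin : Vertex
origin = 0F , 0F

to-origin : ∀ u → ∃ λ (σ : Embedding K₃□K₃ K₃□K₃) → Embedding.to σ u ≡ origin
to-origin (g , h) = to-0 g □ᴱ to-0 h , cong₂ _,_ (transpose-sends g 0F) (transpose-sends h 0F)
  where
  to-0 : Fin 3 → Embedding (K 3) (K 3)
  to-0 i = K-embedding (transpose i 0F) transpose-injective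

sameEdge? : (e f : Edge) → Dec (SameEdge e f)
sameEdge? (a , b) (c , d) = (a ≟ₓ c ×-dec b ≟ₓ d) ⊎-dec (a ≟ₓ d ×-dec b ≟ₓ c)

adjacent? : (u v : Vertex) → Dec (Adj K₃□K₃ u v)
adjacent? (g , h) (g′ , h′) = (g ≟ g′ ×-dec ¬? (h ≟ h′)) ⊎-dec (h ≟ h′ ×-dec ¬? (g ≟ g′))

vertices : List Vertex
vertices = cartesianProduct (allFin 3) (allFin 3)

∈-vertices : ∀ v → v ∈ vertices
∈-vertices (g , h) = ∈-cartesianProduct⁺ (∈-allFin g) (∈-allFin h)

neighbours : Vertex → List Vertex
neighbours u = filter (adjacent? u) vertices

∈-neighbours : ∀ {u v} → Adj K₃□K₃ u v → v ∈ neighbours u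
∈-neighbours {u} {v} = ∈-filter⁺ (adjacent? u) (∈-vertices v)

Unused : List Edge → ∀ {a b} → Walk K₃□K₃ a b → Set
Unused used w = ∀ {d f} → d ∈ edges w → f ∈ used → ¬ SameEdge d f

first-edge-unused : ∀ {used a v b} (e : Adj K₃□K₃ a v) (w : Walk K₃□K₃ v b) →
                    Unused used (step a e w) → ¬ Any (SameEdge (a , v)) used
first-edge-unused _ _ unused clash = let _ , f∈ , same = find clash in unused (here refl) f∈ same

module Enumeration (terminals : List Vertex) where

  mutual
    paths : ℕ → (a b : Vertex) → (visited : List Vertex) → (used : List Edge) → List (List Edge)
    paths zero    a b visited used = []
    paths (suc n) a b visited used = concatMap (extend n a b visited used) (neighbours a)

    extend : ℕ → (a b : Vertex) → List Vertex → List Edge → Vertex → List (List Edge)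
    extend n a b visited used v =
      if does (v ∈? visited) ∨ does (any? (sameEdge? (a , v)) used) then []
      else if does (v ≟ₓ b) then ((a , v) ∷ []) ∷ []
      else if does (v ∈? terminals) then []
      else map ((a , v) ∷_) (paths n v b (v ∷ visited) used)

  Avoids : ∀ {a b} → Walk K₃□K₃ a b → Set
  Avoids w = ∀ {x} → x ∈ terminals → x ∉ interior w

  mutual
    paths-complete : ∀ n {a v b} (e : Adj K₃□K₃ a v) (w : Walk K₃□K₃ v b) {visited used} →
                     len w ℕ.< n → IsPath K₃□K₃ (step a e w) →
                     (∀ {x} → x ∈ verts w → x ∉ visited) → Unused used (step a e w) →
                     Avoids (step a e w) → edges (step a e w) ∈ paths n a b visited used
    paths-complete (suc n) {a} {b = b} e w {visited} {used} (s≤s short) p fresh unused avoids =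
      ∈-concatMap⁺ (extend n a b visited used)
        (Any.map (λ { refl → extend-complete n e w short p fresh unused avoids }) (∈-neighbours e))

    extend-complete : ∀ n {a v b} (e : Adj K₃□K₃ a v) (w : Walk K₃□K₃ v b) {visited used} →
                      len w ≤ n → IsPath K₃□K₃ (step a e w) →
                      (∀ {x} → x ∈ verts w → x ∉ visited) → Unused used (step a e w) →
                      Avoids (step a e w) → edges (step a e w) ∈ extend n a b visited used v
    extend-complete n {a} {v} e (stop _) {visited} {used} _ _ fresh unused _
      rewrite dec-false (v ∈? visited) (fresh (here refl))
            | dec-false (any? (sameEdge? (a , v)) used) (first-edge-unused e (stop v) unused)
            | dec-true (v ≟ₓ v) refl
      = here refl
    extend-complete n {a} {v} {b} e (step _ e′ w) {visited} {used} short (_ ∷ p) fresh unused avoids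
      rewrite dec-false (v ∈? visited) (fresh (here refl))
            | dec-false (any? (sameEdge? (a , v)) used) (first-edge-unused e (step v e′ w) unused)
            | dec-false (v ≟ₓ b) (IsPath⇒ends≢ {e = e′} w p)
            | dec-false (v ∈? terminals) (λ v∈T → avoids v∈T (second∈interior e e′ w))
      = ∈-map⁺ ((a , v) ∷_) (paths-complete n e′ w short p fresh′ (unused ∘ there) avoids′)
      where
      fresh′ : ∀ {x} → x ∈ verts w → x ∉ v ∷ visited
      fresh′ x∈ (here refl)  = All.lookup (AllPairs-head p) x∈ refl
      fresh′ x∈ (there x∈vs) = fresh (there x∈) x∈vs
      avoids′ : Avoids (step v e′ w)
      avoids′ x∈T = avoids x∈T ∘ ∈-interior⇒∈-front (step v e′ w)

  IsPath⇒∈-paths : ∀ {a b} (w : Walk K₃□K₃ a b) {used} → a ≢ b → IsPath K₃□K₃ w → Unused used w →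
                   Avoids w → edges w ∈ paths 8 a b (a ∷ []) used
  IsPath⇒∈-paths (stop _)     a≢a _ = ⊥-elim (a≢a refl)
  IsPath⇒∈-paths (step _ e w) _   p = paths-complete 8 e w short p fresh
    where
    short : len w ℕ.< 8
    short with IsPath⇒len< (step _ e w) p
    ... | s≤s short = short
    fresh : ∀ {x} → x ∈ verts w → x ∉ _ ∷ []
    fresh x∈ (here refl) = All.lookup (AllPairs-head p) x∈ refl

oddᵇ : ℕ → Bool
oddᵇ n = isYes (parity n ℙ.≟ 1ℙ)

Odd⇒oddᵇ : ∀ {n} → Odd n → T (oddᵇ n)
Odd⇒oddᵇ {n} (k , refl) =
  fromWitness {a? = parity n ℙ.≟ 1ℙ} (trans (+-homo-+ 1 (2 * k)) (cong _⁻¹ (*-homo-* 2 k)))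

routable : Vector Vertex 5 → List (Fin 5 × Fin 5) → List Edge → Bool
routable t []             used = true
routable t ((i , j) ∷ ps) used =
  any (λ es → oddᵇ (length es) ∧ routable t ps (es ++ used))
      (Enumeration.paths (tabulate t) 8 (t i) (t j) (t i ∷ []) used)

module _ (I : TOImmersion K₃□K₃ 5) where
  open TOImmersion I

  routable-complete : ∀ {t} → t ≗ term → (ps : List (Fin 5 × Fin 5)) →
                      All (uncurry _<_) ps → Unique ps → (used : List Edge) →
                      (∀ {i j} (i<j : i < j) → (i , j) ∈ ps → Unused used (path i j i<j)) →
                      T (routable t ps used)
  routable-complete t≗ [] _ _ _ _ = _
  routable-complete {t} t≗ ((i , j) ∷ ps) (i<j ∷ ps<) (ij∉ps ∷ ps!) used unused
    rewrite t≗ i | t≗ j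
    = any⁺ _ (Any.map (λ { refl → Equivalence.from T-∧ (odd-path , rest) })
                      (Enumeration.IsPath⇒∈-paths _ P term≢ (isPath i j i<j)
                                                  (unused i<j (here refl)) avoids))
    where
    P = path i j i<j
    term≢ : term i ≢ term j
    term≢ eq with termInj i j eq
    ... | refl = <-irrefl refl i<j
    avoids : ∀ {x} → x ∈ tabulate t → x ∉ interior P
    avoids x∈ with ∈-tabulate⁻ {f = t} x∈
    ... | k , refl = subst (_∉ interior P) (sym (t≗ k)) (noTermInt i j i<j k)
    odd-path : T (oddᵇ (length (edges P)))
    odd-path = Odd⇒oddᵇ (subst Odd (sym (length-edges P)) (odd i j i<j))
    unused′ : ∀ {k l} (k<l : k < l) → (k , l) ∈ ps → Unused (edges P ++ used) (path k l k<l)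
    unused′ {k} {l} k<l kl∈ d∈ f∈ with ∈-++⁻ (edges P) f∈
    ... | inj₁ f∈P    = disjoint k l k<l i j i<j
                          (λ (k≡i , l≡j) → All.lookup ij∉ps kl∈ (sym (cong₂ _,_ k≡i l≡j))) d∈ f∈P
    ... | inj₂ f∈used = unused k<l (there kl∈) d∈ f∈used
    rest : T (routable t ps (edges P ++ used))
    rest = routable-complete t≗ ps ps< ps! (edges P ++ used) unused′

vectors : ∀ n → List (Vector Vertex n)
vectors zero    = Vector.[] ∷ []
vectors (suc n) = cartesianProductWith Vector._∷_ vertices (vectors n)

vectors-complete : ∀ {n} (f : Vector Vertex n) → ∃ λ t → t ∈ vectors n × t ≗ f
vectors-complete {zero}  f = Vector.[] , here refl , λ ()
vectors-complete {suc n} f with vectors-complete (Vector.tail f)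
... | t , t∈ , t≗ = Vector.head f Vector.∷ t
                  , ∈-cartesianProductWith⁺ Vector._∷_ (∈-vertices (Vector.head f)) t∈
                  , λ { zero → refl ; (suc i) → t≗ i }

open DecUnique _≟ₓ_ using (unique?)

candidates : List (Vector Vertex 5)
candidates = filter (unique? ∘ tabulate) (map (origin Vector.∷_) (vectors 4))

pairs : List (Fin 5 × Fin 5)
pairs = (0F , 1F) ∷ (0F , 2F) ∷ (1F , 2F) ∷ (0F , 3F) ∷ (1F , 3F) ∷ (2F , 3F)
      ∷ (0F , 4F) ∷ (1F , 4F) ∷ (2F , 4F) ∷ (3F , 4F) ∷ []

pairs-ordered : All (uncurry _<_) pairs
pairs-ordered = from-yes (All.all? (uncurry _<?_) pairs)

pairs-unique : Unique pairs
pairs-unique = from-yes (DecUnique.unique? (≡-dec (_≟_ {5}) _≟_) pairs)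

unroutable : Vector Vertex 5 → Bool
unroutable t = not (routable t pairs [])

candidates-unroutable : all unroutable candidates ≡ true
candidates-unroutable = refl

all≡true⇒ : ∀ {A : Set} (p : A → Bool) xs → all p xs ≡ true → ∀ {x} → x ∈ xs → p x ≡ true
all≡true⇒ p xs eq x∈ = Equivalence.to T-≡ (All.lookup (all⁺ p xs (Equivalence.from T-≡ eq)) x∈)

not≡true⇒¬T : ∀ {b} → not b ≡ true → ¬ T b
not≡true⇒¬T {true}  () _
not≡true⇒¬T {false} _  ()

-- Stated for an arbitrary candidate t: the type checker then never compares two instances of
-- the search, which would make it rerun it.
candidate-unroutable : ∀ {t} → t ∈ candidates → ¬ T (routable t pairs [])
candidate-unroutable {t} t∈ =
  not≡true⇒¬T {routable t pairs []} (all≡true⇒ unroutable candidates candidates-unroutable t∈)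

no-K₅ : ¬ TOImmersion K₃□K₃ 5
no-K₅ I₀ =
  candidate-unroutable c∈ (routable-complete I {c} c≗term pairs pairs-ordered pairs-unique [] λ _ _ _ ())
  where
  σ,σ-origin = to-origin (TOImmersion.term I₀ 0F)
  I = mapImmersion (proj₁ σ,σ-origin) I₀
  open TOImmersion I
  tail-candidate = vectors-complete (Vector.tail term)
  c : Vector Vertex 5
  c = origin Vector.∷ proj₁ tail-candidate
  c≗term : c ≗ term
  c≗term zero    = sym (proj₂ σ,σ-origin)
  c≗term (suc i) = proj₂ (proj₂ tail-candidate) i
  c∈ : c ∈ candidates
  c∈ = ∈-filter⁺ (unique? ∘ tabulate) (∈-map⁺ (origin Vector.∷_) (proj₁ (proj₂ tail-candidate)))
         (tabulate⁺ λ {i} {j} eq → termInj i j (trans (sym (c≗term i)) (trans eq (c≗term j))))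

toi-K₃□K₃≤4 : ∀ s → TOImmersion K₃□K₃ s → s ≤ 4
toi-K₃□K₃≤4 s I with s ≤? 4
... | yes s≤4 = s≤4
... | no s≰4  = ⊥-elim (no-K₅ (restrict (≰⇒> s≰4) I))

theorem10 : ((G H : Graph) → Connected G → Connected H →
    toi≡ G 3 → toi≡ H 3 → toi≥ (G □ H) 4)
    × toi≡ (K 3 □ K 3) 4
theorem10 =
  (λ G H _ _ (I , _) (J , _) → 4 , ≤-refl , □-immersion I J) ,
  (□-immersion (complete-immersion 3) (complete-immersion 3) , toi-K₃□K₃≤4)
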